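{- Let $\Gamma=(X,\sim)$ be a connected graph such that for every vertex $p$ there are a prime power $q_p$ and an integer $n_p\geq 2$ such that $\Gamma(p)$ is isomorphic to the $q_p$-clique extension of the point graph of the Segre geometry $\mathsf{A}_{1,1}(q_p)\times\mathsf{A}_{n_p,1}(q_p)$. Let $\mathcal L$ be the set of extended rays $(p_1^\perp\cap p_2^\perp)^\perp$ with $p_1\sim p_2$, and let $\Delta=(X,\mathcal L)$. Then for every two vertices $x,y$ at distance $2$ in $\Gamma$, the set $x^\perp\cap y^\perp$, endowed with the members of $\mathcal L$ contained in it, is a $(q+1)\times(q+1)$-grid, where $q+1$ is the size of any extended ray (equivalently $q=q_x$).
   Context: For a set $S$ of vertices, $S^\perp$ is the set of vertices equal or adjacent to every vertex of $S$; $x^\perp=\{x\}^\perp$. $\Gamma(p)$ is the subgraph induced on the neighbours of $p$. The $q$-clique extension of a graph $(Y,\sim)$ has vertices $t_i(y)$, $1\le i\le q$, $y\in Y$, with $t_i(y)\sim t_j(z)$ iff ($y=z$, $i\ne j$) or $y\sim z$. The Segre geometry $\mathsf{A}_{1,1}(q)\times\mathsf{A}_{n,1}(q)$ has point set $\mathsf{PG}(1,q)\times\mathsf{PG}(n,q)$ and lines $\{a\}\times M$ ($a$ a point of $\mathsf{PG}(1,q)$, $M$ a line of $\mathsf{PG}(n,q)$) and $\mathsf{PG}(1,q)\times\{b\}$ ($b$ a point of $\mathsf{PG}(n,q)$); its point graph joins distinct collinear points. A $(q+1)\times(q+1)$-grid is the geometry with point set $A\times B$, $|A|=|B|=q+1$,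 whose lines are the sets $\{a\}\times B$ and $A\times\{b\}$. -}

module Defs where

open import Level using (0ℓ)
open import Data.Nat using (ℕ; zero; suc; _^_; _≤_)
open import Data.Nat.Primality using (Prime)
open import Data.Fin using (Fin)
open import Data.Bool using (Bool; true; false; if_then_else_)
open import Data.Vec using (Vec; []; _∷_; zipWith; map)
open import Data.Product using (Σ; ∃; ∃-syntax; _×_; _,_)
open import Data.Sum using (_⊎_)
open import Data.Empty using (⊥)
open import Relation.Nullary using (¬_; Dec; yes; no)
open import Relation.Binary.PropositionalEquality using (_≡_; _≢_)
open import Function.Bundles using (_↔_)
open import Function.Definitions using (Injective)
open import Algebra.Structures using (IsCommutativeRing)

_⇔′_ : Set → Set → Set
A ⇔′ B = (A → B) × (B → A)

IsPrimePower : ℕ → Set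
IsPrimePower q = ∃[ p ] ∃[ k ] (Prime p × 1 ≤ k × q ≡ p ^ k)

record FiniteField (q : ℕ) : Set₁ where
  field
    Carrier : Set
    _+_ _*_ : Carrier → Carrier → Carrier
    -_      : Carrier → Carrier
    0# 1#   : Carrier
    isCommutativeRing : IsCommutativeRing _≡_ _+_ _*_ -_ 0# 1#
    0≢1     : 0# ≢ 1#
    inverse : ∀ x → x ≢ 0# → ∃[ y ] (x * y ≡ 1#)
    _≟_     : (x y : Carrier) → Dec (x ≡ y)
    card    : Carrier ↔ Fin q

-- The projective space PG(n, F): points are the 1-dim subspaces of F^(n+1),
-- represented by their unique normalised spanning vector (first nonzero
-- coordinate equal to 1).

module Projective {q : ℕ} (F : FiniteField q) where
  open FiniteField F

  isOne : Carrier → Bool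
  isOne x with x ≟ 1#
  ... | yes _ = true
  ... | no  _ = false

  normalised : ∀ {m} → Vec Carrier m → Bool
  normalised []      = false
  normalised (x ∷ v) with x ≟ 0#
  ... | yes _ = normalised v
  ... | no  _ = isOne x

  PGPoint : ℕ → Set
  PGPoint n = Σ (Vec Carrier (suc n)) (λ v → normalised v ≡ true)

  vec : ∀ {n} → PGPoint n → Vec Carrier (suc n)
  vec (v , _) = v

  InSpan : ∀ {m} → Vec Carrier m → Vec Carrier m → Vec Carrier m → Set
  InSpan w u v = ∃[ a ] ∃[ b ] (w ≡ zipWith _+_ (map (a *_) u) (map (b *_) v))

  OnLine : ∀ {n} → PGPoint n → PGPoint n → PGPoint n → Set
  OnLine w u v = InSpan (vec w) (vec u) (vec v)

  Collinear : ∀ {n} → PGPoint n → PGPoint n → Set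
  Collinear {n} b b′ = ∃[ u ] ∃[ v ] (u ≢ v × OnLine b u v × OnLine b′ u v)

  SegrePoint : ℕ → Set
  SegrePoint n = PGPoint 1 × PGPoint n

  -- Point graph: distinct points on a common line, where lines are
  -- {a} × M (M a line of PG(n,q)) and PG(1,q) × {b}.
  SegreAdj : ∀ {n} → SegrePoint n → SegrePoint n → Set
  SegreAdj (a , b) (a′ , b′) =
    (a , b) ≢ (a′ , b′) × ((a ≡ a′ × Collinear b b′) ⊎ b ≡ b′)

-- q-clique extension of a graph (Y, ∼): vertices t_i(y) = (i , y)

CliqueExt : (q : ℕ) (Y : Set) → Set
CliqueExt q Y = Fin q × Y

CliqueExtAdj : {q : ℕ} {Y : Set} (_∼_ : Y → Y → Set) →
               CliqueExt q Y → CliqueExt q Y → Set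
CliqueExtAdj _∼_ (i , y) (j , z) = (y ≡ z × i ≢ j) ⊎ y ∼ z

-- Graphs: a vertex type with a (Bool-valued, hence proof-irrelevant)
-- symmetric irreflexive adjacency relation.

record Graph : Set₁ where
  field
    X     : Set
    adj   : X → X → Bool
    sym   : ∀ x y → adj x y ≡ adj y x
    irrefl : ∀ x → adj x x ≡ false

  _∼_ : X → X → Set
  x ∼ y = adj x y ≡ true

  data Path : X → X → Set where
    here  : ∀ {x} → Path x x
    step  : ∀ {x y z} → x ∼ y → Path y z → Path x z

  Connected : Set
  Connected = ∀ x y → Path x y

  Dist2 : X → X → Set
  Dist2 x y = x ≢ y × ¬ (x ∼ y) × ∃[ z ] (x ∼ z × z ∼ y)

  Subset : Set₁
  Subset = X → Set

  _⊥ₛ : Subset → Subset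
  (S ⊥ₛ) z = ∀ s → S s → (z ≡ s ⊎ z ∼ s)

  _⊥ᵥ : X → Subset
  (x ⊥ᵥ) z = z ≡ x ⊎ z ∼ x

  _∩_ : Subset → Subset → Subset
  (S ∩ T) z = S z × T z

  _⊆_ : Subset → Subset → Set
  S ⊆ T = ∀ z → S z → T z

  _≐_ : Subset → Subset → Set
  S ≐ T = ∀ z → S z ⇔′ T z

  Ray : X → X → Subset
  Ray p₁ p₂ = ((p₁ ⊥ᵥ) ∩ (p₂ ⊥ᵥ)) ⊥ₛ

  InL : Subset → Set
  InL L = ∃[ p₁ ] ∃[ p₂ ] (p₁ ∼ p₂ × L ≐ Ray p₁ p₂)

  LocallyIso : X → (V : Set) → (V → V → Set) → Set
  LocallyIso p V _≈_ =
    Σ (V → X) λ f →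
      Injective _≡_ _≡_ f ×
      (∀ v → p ∼ f v) ×
      (∀ x → p ∼ x → ∃[ v ] (f v ≡ x)) ×
      (∀ v w → (f v ∼ f w) ⇔′ (v ≈ w))

  record LocalSegre (p : X) : Set₁ where
    field
      q     : ℕ
      q-pp  : IsPrimePower q
      GF    : FiniteField q
      n     : ℕ
      2≤n   : 2 ≤ n
      iso   : LocallyIso p
                (CliqueExt q (Projective.SegrePoint GF n))
                (CliqueExtAdj (Projective.SegreAdj GF {n}))

  IsGridInduced : ℕ → Subset → Set₁
  IsGridInduced m P =
    Σ (Fin m × Fin m → X) λ g →
      Injective _≡_ _≡_ g ×
      (∀ c → P (g c)) ×
      (∀ z → P z → ∃[ c ] (g c ≡ z)) ×
      (∀ L → InL L → L ⊆ P →
          (∃[ i ] (L ≐ (λ z → ∃[ j ] (z ≡ g (i , j)))))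
        ⊎ (∃[ j ] (L ≐ (λ z → ∃[ i ] (z ≡ g (i , j)))))) ×
      (∀ i → InL (λ z → ∃[ j ] (z ≡ g (i , j)))) ×
      (∀ j → InL (λ z → ∃[ i ] (z ≡ g (i , j))))

-- Inside Γ(p) two vertices are equal or adjacent iff their Segre points share a coordinate, since
-- any two points of PG(n, q) are collinear. Hence the extended ray through p and a neighbour is p
-- together with one fibre of the clique extension: it has q_p + 1 vertices, and adjacent vertices
-- have the same q. For z in P = x^⊥ ∩ y^⊥, the vertices x and y sit in Γ(z) at points sharing no
-- coordinate, so P ∩ Γ(z) is the union of two fibres. Seen from Γ(x), distinct members of P have
-- distinct points of PG(1, q) × PG(n, q), and the two fibres at z are the remaining members of P
-- with the same second, respectively first, coordinate as z: the column and the row through z.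
-- A column has q + 1 members with distinct first coordinates, so it meets every point of PG(1, q).
-- Therefore P is PG(1, q) times the q + 1 second coordinates met by the row through a fixed member
-- of P, and the extended rays inside P are its rows and columns.

module Submission where

open import Defs
open import Algebra.Structures using (IsCommutativeRing)
open import Axiom.UniquenessOfIdentityProofs using (module Decidable⇒UIP)
open import Data.Bool using (true)
import Data.Bool.Properties as Bool
open import Data.Empty using (⊥-elim)
open import Data.Fin using (Fin; zero; suc; punchOut)
open import Data.Fin.Properties
  using (suc-injective; any?; injective⇒≤; punchOut-injective; cantor-schröder-bernstein)
  renaming (_≟_ to _≟ᶠ_)
open import Data.Nat using (ℕ; suc; _≤_; s≤s; z≤n)
import Data.Nat.Properties as ℕ
open import Data.Product using (Σ; ∃-syntax; _×_; _,_; proj₁; proj₂; swap)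
import Data.Product as Product
open import Data.Sum using (_⊎_; inj₁; inj₂)
import Data.Sum as Sum
open import Data.Vec using (Vec; []; _∷_; zipWith; map; replicate; head)
open import Data.Vec.Properties using (≡-dec)
open import Function.Base using (_∘_)
open import Function.Bundles using (Inverse; Injection)
open import Function.Definitions using (Injective)
open import Function.Properties.Inverse using (↔⇒↣)
open import Relation.Binary.PropositionalEquality
open import Relation.Nullary using (¬_; Dec; yes; no; contradiction)

injective⇒surjective : ∀ {m n} {f : Fin m → Fin n} → n ≤ m → Injective _≡_ _≡_ f →
                       ∀ t → ∃[ k ] (f k ≡ t)
injective⇒surjective {n = suc _} {f} n≤m f-injective t with any? (λ k → f k ≟ᶠ t)
... | yes found = found
... | no  ¬found = contradiction n≤m (ℕ.≤⇒≯ (injective⇒≤ punchOut∘f-injective))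
  where
  t≢f : ∀ k → t ≢ f k
  t≢f k t≡fk = ¬found (k , sym t≡fk)
  punchOut∘f-injective : Injective _≡_ _≡_ (λ k → punchOut (t≢f k))
  punchOut∘f-injective {a} {b} eq = f-injective (punchOut-injective (t≢f a) (t≢f b) eq)

same-image⇒same-size : ∀ {m n} {A : Set} {f : Fin m → A} {g : Fin n → A} →
                       Injective _≡_ _≡_ f → Injective _≡_ _≡_ g →
                       (∀ i → ∃[ j ] (g j ≡ f i)) → (∀ j → ∃[ i ] (f i ≡ g j)) → m ≡ n
same-image⇒same-size {f = f} {g} f-injective g-injective f⊆g g⊆f =
  cantor-schröder-bernstein (embed f-injective f⊆g) (embed g-injective g⊆f)
  where
  embed : ∀ {m n} {A : Set} {f : Fin m → A} {g : Fin n → A} → Injective _≡_ _≡_ f →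
          (⊆ : ∀ i → ∃[ j ] (g j ≡ f i)) → Injective _≡_ _≡_ (λ i → proj₁ (⊆ i))
  embed {g = g} f-injective ⊆ {a} {b} eq =
    f-injective (trans (sym (proj₂ (⊆ a))) (trans (cong g eq) (proj₂ (⊆ b))))

module ProjectiveSpace {q : ℕ} (F : FiniteField q) where
  open FiniteField F
  open Projective F
  open IsCommutativeRing isCommutativeRing
    using (*-identityˡ; zeroˡ; +-identityʳ; +-identityˡ)

  someIndex : Fin q
  someIndex = Inverse.to card 0#

  point-≡ : ∀ {m} {u v : PGPoint m} → vec u ≡ vec v → u ≡ v
  point-≡ {u = u , _} refl = cong (u ,_) (Decidable⇒UIP.≡-irrelevant Bool._≟_ _ _)

  _≟ₚ_ : ∀ {m} (u v : PGPoint m) → Dec (u ≡ v)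
  u ≟ₚ v with ≡-dec _≟_ (vec u) (vec v)
  ... | yes u≡v = yes (point-≡ u≡v)
  ... | no  u≢v = no λ { refl → u≢v refl }

  isOne⇒≡1 : ∀ {x} → isOne x ≡ true → x ≡ 1#
  isOne⇒≡1 {x} h with x ≟ 1#
  ... | yes x≡1 = x≡1

  normalised-1∷ : ∀ {m} (v : Vec Carrier m) → normalised (1# ∷ v) ≡ true
  normalised-1∷ v with 1# ≟ 0#
  ... | yes 1≡0 = ⊥-elim (0≢1 (sym 1≡0))
  ... | no _ with 1# ≟ 1#
  ...   | yes _ = refl
  ...   | no 1≢1 = ⊥-elim (1≢1 refl)

  normalised-0∷ : ∀ {m} (v : Vec Carrier m) → normalised (0# ∷ v) ≡ normalised v
  normalised-0∷ v with 0# ≟ 0#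
  ... | yes _ = refl
  ... | no 0≢0 = ⊥-elim (0≢0 refl)

  e₀ e₁ : ∀ {m} → PGPoint (suc m)
  e₀ = 1# ∷ replicate _ 0# , normalised-1∷ _
  e₁ = 0# ∷ 1# ∷ replicate _ 0# , trans (normalised-0∷ _) (normalised-1∷ _)

  another : ∀ {m} → 1 ≤ m → (b : PGPoint m) → ∃[ c ] (c ≢ b)
  another (s≤s _) b with b ≟ₚ e₀
  ... | yes refl = e₁ , λ e₁≡e₀ → 0≢1 (cong (λ u → head (vec u)) e₁≡e₀)
  ... | no b≢e₀  = e₀ , λ e₀≡b → b≢e₀ (sym e₀≡b)

  onLine-left : ∀ {m} (u v : PGPoint m) → OnLine u u v
  onLine-left u v = 1# , 0# , span (vec u) (vec v)
    where
    span : ∀ {k} (u v : Vec Carrier k) → u ≡ zipWith _+_ (map (1# *_) u) (map (0# *_) v)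
    span []      []      = refl
    span (a ∷ u) (b ∷ v) =
      cong₂ _∷_ (sym (trans (cong₂ _+_ (*-identityˡ a) (zeroˡ b)) (+-identityʳ a))) (span u v)

  onLine-right : ∀ {m} (u v : PGPoint m) → OnLine v u v
  onLine-right u v = 0# , 1# , span (vec u) (vec v)
    where
    span : ∀ {k} (u v : Vec Carrier k) → v ≡ zipWith _+_ (map (0# *_) u) (map (1# *_) v)
    span []      []      = refl
    span (a ∷ u) (b ∷ v) =
      cong₂ _∷_ (sym (trans (cong₂ _+_ (zeroˡ a) (*-identityˡ b)) (+-identityˡ b))) (span u v)

  collinear : ∀ {m} → 1 ≤ m → (b b′ : PGPoint m) → Collinear b b′
  collinear 1≤m b b′ with b ≟ₚ b′
  ... | yes refl = let c , c≢b = another 1≤m b in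
                   b , c , (λ b≡c → c≢b (sym b≡c)) , onLine-left b c , onLine-left b c
  ... | no b≢b′  = b , b′ , b≢b′ , onLine-left b b′ , onLine-right b b′

  toFin : PGPoint 1 → Fin (suc q)
  toFin (x ∷ y ∷ [] , _) with x ≟ 0#
  ... | yes _ = zero
  ... | no  _ = suc (Inverse.to card y)

  normalised-singleton : ∀ {y} → normalised (y ∷ []) ≡ true → y ≡ 1#
  normalised-singleton {y} h with y ≟ 0#
  ... | no _ = isOne⇒≡1 h

  toFin-injective : Injective _≡_ _≡_ toFin
  toFin-injective {u} {v} eq = point-≡ (vec-injective (vec u) (vec v) (proj₂ u) (proj₂ v) eq)
    where
    vec-injective : ∀ u v (h : normalised u ≡ true) (h′ : normalised v ≡ true) →
                    toFin (u , h) ≡ toFin (v , h′) → u ≡ v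
    vec-injective (x ∷ y ∷ []) (x′ ∷ y′ ∷ []) h h′ eq with x ≟ 0# | x′ ≟ 0#
    ... | yes x≡0 | yes x′≡0 = cong₂ (λ a b → a ∷ b ∷ [])
          (trans x≡0 (sym x′≡0)) (trans (normalised-singleton h) (sym (normalised-singleton h′)))
    ... | no _ | no _ = cong₂ (λ a b → a ∷ b ∷ [])
          (trans (isOne⇒≡1 h) (sym (isOne⇒≡1 h′))) (Injection.injective (↔⇒↣ card) (suc-injective eq))

Shared : {A B : Set} → A × B → A × B → Set
Shared s t = proj₁ s ≡ proj₁ t ⊎ proj₂ s ≡ proj₂ t

module _ {A B : Set} where

  ≡⇒Shared : {s t : A × B} → s ≡ t → Shared s t
  ≡⇒Shared refl = inj₁ refl

  Shared-sym : {s t : A × B} → Shared s t → Shared t s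
  Shared-sym (inj₁ eq) = inj₁ (sym eq)
  Shared-sym (inj₂ eq) = inj₂ (sym eq)

  Shared-swap : {s t : A × B} → Shared s t → Shared (swap s) (swap t)
  Shared-swap (inj₁ eq) = inj₂ eq
  Shared-swap (inj₂ eq) = inj₁ eq

  shared-with-both : {s t u : A × B} → ¬ Shared s t → Shared u s → Shared u t →
                     u ≡ (proj₁ s , proj₂ t) ⊎ u ≡ (proj₁ t , proj₂ s)
  shared-with-both ¬st (inj₁ u≡s) (inj₁ u≡t) = ⊥-elim (¬st (inj₁ (trans (sym u≡s) u≡t)))
  shared-with-both ¬st (inj₁ u≡s) (inj₂ u≡t) = inj₁ (cong₂ _,_ u≡s u≡t)
  shared-with-both ¬st (inj₂ u≡s) (inj₁ u≡t) = inj₂ (cong₂ _,_ u≡t u≡s)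
  shared-with-both ¬st (inj₂ u≡s) (inj₂ u≡t) = ⊥-elim (¬st (inj₂ (trans (sym u≡s) u≡t)))

  corners-unshared : {s t : A × B} → ¬ Shared s t →
                     ¬ Shared (proj₁ s , proj₂ t) (proj₁ t , proj₂ s)
  corners-unshared ¬st (inj₁ eq) = ¬st (inj₁ eq)
  corners-unshared ¬st (inj₂ eq) = ¬st (inj₂ (sym eq))

  separating-point : (∀ (a : A) → ∃[ a′ ] (a′ ≢ a)) → (∀ (b : B) → ∃[ b′ ] (b′ ≢ b)) →
                     {s t : A × B} → t ≢ s → Shared t s → ∃[ u ] (Shared u s × ¬ Shared t u)
  separating-point anotherᴬ _ {s} t≢s (inj₁ t₁≡s₁) =
    let a , a≢s₁ = anotherᴬ (proj₁ s) in
    (a , proj₂ s) , inj₂ refl , λ where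
      (inj₁ t₁≡a) → a≢s₁ (trans (sym t₁≡a) t₁≡s₁)
      (inj₂ t₂≡s₂) → t≢s (cong₂ _,_ t₁≡s₁ t₂≡s₂)
  separating-point _ anotherᴮ {s} t≢s (inj₂ t₂≡s₂) =
    let b , b≢s₂ = anotherᴮ (proj₂ s) in
    (proj₁ s , b) , inj₁ refl , λ where
      (inj₁ t₁≡s₁) → t≢s (cong₂ _,_ t₁≡s₁ t₂≡s₂)
      (inj₂ t₂≡b) → b≢s₂ (trans (sym t₂≡b) t₂≡s₂)

  Shared⇒≡₂ : {u v z : A × B} → Shared u v → Shared u z →
              proj₁ v ≢ proj₁ z → proj₂ v ≡ proj₂ z → proj₂ u ≡ proj₂ z
  Shared⇒≡₂ (inj₂ u≡v) _ _ v≡z = trans u≡v v≡z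
  Shared⇒≡₂ (inj₁ u≡v) (inj₁ u≡z) v≢z _ = ⊥-elim (v≢z (trans (sym u≡v) u≡z))
  Shared⇒≡₂ (inj₁ _) (inj₂ u≡z) _ _ = u≡z

  ¬Shared⇒≡₁ : {u v z : A × B} → ¬ Shared u v → Shared u z → proj₂ v ≡ proj₂ z →
               proj₁ u ≡ proj₁ z
  ¬Shared⇒≡₁ _ (inj₁ u≡z) _ = u≡z
  ¬Shared⇒≡₁ ¬uv (inj₂ u≡z) v≡z = ⊥-elim (¬uv (inj₂ (trans u≡z (sym v≡z))))

module _ (Γ : Graph) where
  open Graph Γ renaming (sym to adj-sym; irrefl to adj-irrefl)

  ∼-sym : ∀ {u v} → u ∼ v → v ∼ u
  ∼-sym {u} {v} u∼v = trans (adj-sym v u) u∼v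

  ∼-irrefl : ∀ {u} → ¬ u ∼ u
  ∼-irrefl {u} u∼u with trans (sym u∼u) (adj-irrefl u)
  ... | ()

  ∼⇒≢ : ∀ {u v} → u ∼ v → u ≢ v
  ∼⇒≢ u∼v refl = ∼-irrefl u∼v

  ⊥ᵥ-sym : ∀ {u v} → (v ⊥ᵥ) u → (u ⊥ᵥ) v
  ⊥ᵥ-sym (inj₁ refl) = inj₁ refl
  ⊥ᵥ-sym (inj₂ u∼v) = inj₂ (∼-sym u∼v)

  ≐-sym : ∀ {S T} → S ≐ T → T ≐ S
  ≐-sym S≐T z = proj₂ (S≐T z) , proj₁ (S≐T z)

  ≐-trans : ∀ {S T U} → S ≐ T → T ≐ U → S ≐ U
  ≐-trans S≐T T≐U z = (λ Sz → proj₁ (T≐U z) (proj₁ (S≐T z) Sz)) ,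
                      (λ Uz → proj₂ (S≐T z) (proj₂ (T≐U z) Uz))

  Ray-comm : ∀ p p′ → Ray p p′ ≐ Ray p′ p
  Ray-comm p p′ z = (λ R w (w⊥p′ , w⊥p) → R w (w⊥p , w⊥p′)) ,
                    (λ R w (w⊥p , w⊥p′) → R w (w⊥p′ , w⊥p))

  Ray-∋-left : ∀ p p′ → Ray p p′ p
  Ray-∋-left p p′ w (w⊥p , _) = ⊥ᵥ-sym w⊥p

  InL-resp-≐ : ∀ {L M} → L ≐ M → InL M → InL L
  InL-resp-≐ L≐M (p , p′ , p∼p′ , M≐Ray) = p , p′ , p∼p′ , ≐-trans L≐M M≐Ray

  record Enumeration (m : ℕ) (S : Subset) : Set where
    field
      elem           : Fin m → X
      elem-injective : Injective _≡_ _≡_ elem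
      elem-∈         : ∀ i → S (elem i)
      elem-onto      : ∀ {w} → S w → ∃[ i ] (elem i ≡ w)

  Enumeration-resp-≐ : ∀ {m S T} → S ≐ T → Enumeration m S → Enumeration m T
  Enumeration-resp-≐ S≐T E = record
    { elem           = elem
    ; elem-injective = elem-injective
    ; elem-∈         = λ i → proj₁ (S≐T _) (elem-∈ i)
    ; elem-onto      = λ Tw → elem-onto (proj₂ (S≐T _) Tw)
    }
    where open Enumeration E

  Enumeration-size : ∀ {m n S} → Enumeration m S → Enumeration n S → m ≡ n
  Enumeration-size E E′ = same-image⇒same-size (elem-injective E) (elem-injective E′)
    (λ i → elem-onto E′ (elem-∈ E i)) (λ j → elem-onto E (elem-∈ E′ j))
    where open Enumeration

  module Neighbourhood {p : X} (L : LocalSegre p) where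
    open LocalSegre L public using (q; GF; n)
    open LocalSegre L using (2≤n; iso)
    open Projective GF using (SegrePoint; SegreAdj)
    open ProjectiveSpace GF public using (someIndex; _≟ₚ_; toFin; toFin-injective)
    open ProjectiveSpace GF using (another; collinear)

    Point : Set
    Point = SegrePoint n

    vertex : Fin q × Point → X
    vertex = proj₁ iso

    vertex-injective : Injective _≡_ _≡_ vertex
    vertex-injective = proj₁ (proj₂ iso)

    vertex-∼ : ∀ v → p ∼ vertex v
    vertex-∼ = proj₁ (proj₂ (proj₂ iso))

    vertex-onto : ∀ w → p ∼ w → ∃[ v ] (vertex v ≡ w)
    vertex-onto = proj₁ (proj₂ (proj₂ (proj₂ iso)))

    vertex-adjacency : ∀ v w → (vertex v ∼ vertex w) ⇔′ CliqueExtAdj SegreAdj v w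
    vertex-adjacency = proj₂ (proj₂ (proj₂ (proj₂ iso)))

    1≤n : 1 ≤ n
    1≤n = ℕ.≤-trans (s≤s z≤n) 2≤n

    _≟ᵖ_ : (s t : Point) → Dec (s ≡ t)
    (a , b) ≟ᵖ (a′ , b′) with a ≟ₚ a′ | b ≟ₚ b′
    ... | yes refl | yes refl = yes refl
    ... | no a≢a′  | _        = no λ eq → a≢a′ (cong proj₁ eq)
    ... | _        | no b≢b′  = no λ eq → b≢b′ (cong proj₂ eq)

    At : X → Point → Set
    At w s = ∃[ k ] (vertex (k , s) ≡ w)

    point-of : ∀ {w} → p ∼ w → ∃[ s ] (At w s)
    point-of {w} p∼w = let (k , s) , eq = vertex-onto w p∼w in s , k , eq

    At-unique : ∀ {w s t} → At w s → At w t → s ≡ t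
    At-unique (k , refl) (l , eq) = cong proj₂ (vertex-injective (sym eq))

    At⇒∼ : ∀ {w s} → At w s → p ∼ w
    At⇒∼ (k , refl) = vertex-∼ _

    fibre-∼ : ∀ {k l s} → k ≢ l → vertex (k , s) ∼ vertex (l , s)
    fibre-∼ {k} {l} {s} k≢l = proj₂ (vertex-adjacency (k , s) (l , s)) (inj₁ (refl , k≢l))

    Shared⇒SegreAdj : ∀ {s t : Point} → s ≢ t → Shared s t → SegreAdj s t
    Shared⇒SegreAdj {s} {t} s≢t (inj₁ a≡a′) =
      s≢t , inj₁ (a≡a′ , collinear 1≤n (proj₂ s) (proj₂ t))
    Shared⇒SegreAdj s≢t (inj₂ b≡b′) = s≢t , inj₂ b≡b′

    ⊥⇔Shared : ∀ {u w s t} → At u s → At w t → (w ⊥ᵥ) u ⇔′ Shared s t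
    ⊥⇔Shared {s = s} {t} (k , refl) (l , refl) = to , from
      where
      to : (vertex (l , t) ⊥ᵥ) (vertex (k , s)) → Shared s t
      to (inj₁ eq) = ≡⇒Shared (cong proj₂ (vertex-injective eq))
      to (inj₂ adj) with proj₁ (vertex-adjacency (k , s) (l , t)) adj
      ... | inj₁ (s≡t , _)             = ≡⇒Shared s≡t
      ... | inj₂ (_ , inj₁ (a≡a′ , _)) = inj₁ a≡a′
      ... | inj₂ (_ , inj₂ b≡b′)       = inj₂ b≡b′
      from : Shared s t → (vertex (l , t) ⊥ᵥ) (vertex (k , s))
      from st with s ≟ᵖ t
      from st | no s≢t =
        inj₂ (proj₂ (vertex-adjacency (k , s) (l , t)) (inj₂ (Shared⇒SegreAdj s≢t st)))
      from st | yes refl with k ≟ᶠ l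
      ... | yes refl = inj₁ refl
      ... | no k≢l   = inj₂ (fibre-∼ k≢l)

    line : Point → Fin (suc q) → X
    line s zero    = p
    line s (suc k) = vertex (k , s)

    line-injective : ∀ s → Injective _≡_ _≡_ (line s)
    line-injective s {zero}  {zero}  _  = refl
    line-injective s {zero}  {suc _} eq = ⊥-elim (∼⇒≢ (vertex-∼ _) eq)
    line-injective s {suc _} {zero}  eq = ⊥-elim (∼⇒≢ (vertex-∼ _) (sym eq))
    line-injective s {suc _} {suc _} eq = cong (suc ∘ proj₁) (vertex-injective eq)

    Line : Point → Subset
    Line s w = ∃[ i ] (line s i ≡ w)

    line-enumeration : ∀ s → Enumeration (suc q) (Line s)
    line-enumeration s = record
      { elem           = line s
      ; elem-injective = line-injective s
      ; elem-∈         = λ i → i , refl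
      ; elem-onto      = λ w∈ → w∈
      }

    Line⇒At : ∀ {s w} → Line s w → w ≢ p → At w s
    Line⇒At (zero  , refl) w≢p = ⊥-elim (w≢p refl)
    Line⇒At (suc k , refl) _   = k , refl

    ray≐line : ∀ {p′ s} → At p′ s → Ray p p′ ≐ Line s
    ray≐line {p′} {s} p′∈s z = ray⇒line , line⇒ray
      where
      p′∈p⊥ : (p ⊥ᵥ) p′
      p′∈p⊥ = inj₂ (∼-sym (At⇒∼ p′∈s))

      ray⇒line : Ray p p′ z → Line s z
      ray⇒line R with R p (inj₁ refl , ⊥ᵥ-sym p′∈p⊥)
      ... | inj₁ refl = zero , refl
      ... | inj₂ z∼p with point-of (∼-sym z∼p)
      ... | t , z∈t@(k , refl) with t ≟ᵖ s
      ... | yes refl = suc k , refl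
      ... | no t≢s = ⊥-elim (¬tu (proj₁ (⊥⇔Shared z∈t w∈u) (R w (w∈p⊥ , w∈p′⊥))))
        where
        ts : Shared t s
        ts = proj₁ (⊥⇔Shared z∈t p′∈s) (R p′ (p′∈p⊥ , inj₁ refl))
        separation = separating-point (another (s≤s z≤n)) (another 1≤n) t≢s ts
        u = proj₁ separation
        ¬tu = proj₂ (proj₂ separation)
        w = vertex (someIndex , u)
        w∈u : At w u
        w∈u = someIndex , refl
        w∈p⊥ = inj₂ (∼-sym (vertex-∼ _))
        w∈p′⊥ = proj₂ (⊥⇔Shared w∈u p′∈s) (proj₁ (proj₂ separation))

      line⇒ray : Line s z → Ray p p′ z
      line⇒ray (zero  , refl) w (w⊥p , _) = ⊥ᵥ-sym w⊥p
      line⇒ray (suc k , refl) w (inj₁ refl , _) = inj₂ (∼-sym (vertex-∼ _))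
      line⇒ray (suc k , refl) w (inj₂ w∼p , w⊥p′) =
        let t , w∈t = point-of (∼-sym w∼p) in
        proj₂ (⊥⇔Shared (k , refl) w∈t) (Shared-sym (proj₁ (⊥⇔Shared w∈t p′∈s) w⊥p′))

    ⊥-through-point : ∀ {u w v s t} → At u s → At w s → At v t → (u ⊥ᵥ) v → (w ⊥ᵥ) v
    ⊥-through-point u∈s w∈s v∈t v⊥u = proj₂ (⊥⇔Shared v∈t w∈s) (proj₁ (⊥⇔Shared v∈t u∈s) v⊥u)

    ray≐ : ∀ {s S p′} → Line s ≐ S → S p′ → p′ ≢ p → Ray p p′ ≐ S
    ray≐ Line≐S p′∈S p′≢p = ≐-trans (ray≐line (Line⇒At (proj₂ (Line≐S _) p′∈S) p′≢p)) Line≐S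

  module _ (loc : (p : X) → LocalSegre p) where
    module N (p : X) = Neighbourhood (loc p)

    ray-enumeration : ∀ {p p′} → p ∼ p′ → Enumeration (suc (N.q p)) (Ray p p′)
    ray-enumeration {p} p∼p′ =
      let s , p′∈s = N.point-of p p∼p′ in
      Enumeration-resp-≐ (≐-sym (N.ray≐line p p′∈s)) (N.line-enumeration p s)

    q-≡ : ∀ {p p′} → p ∼ p′ → N.q p ≡ N.q p′
    q-≡ {p} {p′} p∼p′ = ℕ.suc-injective (Enumeration-size (ray-enumeration p∼p′)
      (Enumeration-resp-≐ (Ray-comm p′ p) (ray-enumeration (∼-sym p∼p′))))

    module CommonNeighbours {x y : X} (dist : Dist2 x y) where
      module Γx = N x

      P : Subset
      P = (x ⊥ᵥ) ∩ (y ⊥ᵥ)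

      x∉y⊥ : ¬ (y ⊥ᵥ) x
      x∉y⊥ (inj₁ x≡y) = proj₁ dist x≡y
      x∉y⊥ (inj₂ x∼y) = proj₁ (proj₂ dist) x∼y

      P⇒∼ : ∀ {w} → P w → x ∼ w × y ∼ w
      P⇒∼ (inj₁ refl , y⊥x)       = ⊥-elim (x∉y⊥ y⊥x)
      P⇒∼ (inj₂ w∼x  , inj₁ refl) = ⊥-elim (x∉y⊥ (inj₂ (∼-sym w∼x)))
      P⇒∼ (inj₂ w∼x  , inj₂ w∼y)  = ∼-sym w∼x , ∼-sym w∼y

      record Split (z : X) : Set where
        module Z = N z
        field
          σ₁ σ₂    : Z.Point
          apart    : ¬ Shared σ₁ σ₂
          fibre₁⊆P : ∀ k → P (Z.vertex (k , σ₁))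
          fibre₂⊆P : ∀ k → P (Z.vertex (k , σ₂))
          covers   : ∀ {w} → P w → z ∼ w → Z.At w σ₁ ⊎ Z.At w σ₂

        unrelated : ∀ {v w} → Z.At v σ₁ → Z.At w σ₂ → ¬ (w ⊥ᵥ) v
        unrelated v∈σ₁ w∈σ₂ w⊥v = apart (proj₁ (Z.⊥⇔Shared v∈σ₁ w∈σ₂) w⊥v)

        unrelated-neighbour : ∀ {w} → P w → z ∼ w → ∃[ v ] (P v × z ∼ v × ¬ (w ⊥ᵥ) v)
        unrelated-neighbour hw z∼w with covers hw z∼w
        ... | inj₁ w∈σ₁ = _ , fibre₂⊆P Z.someIndex , Z.vertex-∼ _ ,
                          λ w⊥v → unrelated w∈σ₁ (Z.someIndex , refl) (⊥ᵥ-sym w⊥v)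
        ... | inj₂ w∈σ₂ = _ , fibre₁⊆P Z.someIndex , Z.vertex-∼ _ ,
                          unrelated (Z.someIndex , refl) w∈σ₂

      -- In Γ(z), x and y sit at points (a , b) and (a′ , b′) with a ≢ a′ and b ≢ b′, and their
      -- common neighbours are exactly the vertices at (a , b′) and (a′ , b).
      split : ∀ {z} → P z → Split z
      split {z} hz = record
        { σ₁ = proj₁ sx , proj₂ sy ; σ₂ = proj₁ sy , proj₂ sx
        ; apart    = corners-unshared ¬Shared-xy
        ; fibre₁⊆P = fibre⊆P (inj₁ refl) (inj₂ refl)
        ; fibre₂⊆P = fibre⊆P (inj₂ refl) (inj₁ refl)
        ; covers   = covers
        }
        where
        module Z = N z
        sx = proj₁ (Z.point-of (∼-sym (proj₁ (P⇒∼ hz))))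
        x∈sx = proj₂ (Z.point-of (∼-sym (proj₁ (P⇒∼ hz))))
        sy = proj₁ (Z.point-of (∼-sym (proj₂ (P⇒∼ hz))))
        y∈sy = proj₂ (Z.point-of (∼-sym (proj₂ (P⇒∼ hz))))

        ¬Shared-xy : ¬ Shared sx sy
        ¬Shared-xy sh = x∉y⊥ (proj₂ (Z.⊥⇔Shared x∈sx y∈sy) sh)

        fibre⊆P : ∀ {t} → Shared t sx → Shared t sy → ∀ k → P (Z.vertex (k , t))
        fibre⊆P tx ty k = proj₂ (Z.⊥⇔Shared (k , refl) x∈sx) tx , proj₂ (Z.⊥⇔Shared (k , refl) y∈sy) ty

        covers : ∀ {w} → P w → z ∼ w → Z.At w (proj₁ sx , proj₂ sy) ⊎ Z.At w (proj₁ sy , proj₂ sx)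
        covers (w⊥x , w⊥y) z∼w with Z.point-of z∼w
        ... | t , w∈t with shared-with-both ¬Shared-xy (proj₁ (Z.⊥⇔Shared w∈t x∈sx) w⊥x)
                                                       (proj₁ (Z.⊥⇔Shared w∈t y∈sy) w⊥y)
        ... | inj₁ refl = inj₁ w∈t
        ... | inj₂ refl = inj₂ w∈t

      -- Two members of P at the same point of Γ(x) are adjacent, so one lies in a fibre of the
      -- other's split; a vertex of the opposite fibre is ⊥ to one of them but not to the other,
      -- whereas inside Γ(x) vertices at the same point are ⊥ to the same vertices.
      At-x-injective : ∀ {u w s} → P u → P w → Γx.At u s → Γx.At w s → u ≡ w
      At-x-injective hu hw (k , refl) (l , refl) with k ≟ᶠ l
      ... | yes refl = refl
      ... | no k≢l =
        let v , hv , u∼v , ¬w⊥v = Split.unrelated-neighbour (split hu) hw (Γx.fibre-∼ k≢l)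
            t , v∈t = Γx.point-of (proj₁ (P⇒∼ hv))
        in ⊥-elim (¬w⊥v (Γx.⊥-through-point (k , refl) (l , refl) v∈t (inj₂ (∼-sym u∼v))))

      -- Abstracted from the coordinates in Γ(x) so that rows and columns are handled by one
      -- argument up to transpose.
      record Coordinates (A B : Set) : Set where
        field
          κ             : ∀ {w} → P w → A × B
          κ-irrelevant  : ∀ {w} (h h′ : P w) → κ h ≡ κ h′
          κ-injective   : ∀ {u w} (hu : P u) (hw : P w) → κ hu ≡ κ hw → u ≡ w
          ⊥⇔Shared-κ    : ∀ {u w} (hu : P u) (hw : P w) → (w ⊥ᵥ) u ⇔′ Shared (κ hu) (κ hw)

        κ-resp : ∀ {u w} (hu : P u) (hw : P w) → u ≡ w → κ hu ≡ κ hw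
        κ-resp hu hw refl = κ-irrelevant hu hw

      transpose : ∀ {A B} → Coordinates A B → Coordinates B A
      transpose C = record
        { κ            = λ hw → proj₂ (κ hw) , proj₁ (κ hw)
        ; κ-irrelevant = λ h h′ → cong swap (κ-irrelevant h h′)
        ; κ-injective  = λ hu hw eq → κ-injective hu hw (cong swap eq)
        ; ⊥⇔Shared-κ   = λ hu hw → (λ w⊥u → Shared-swap (proj₁ (⊥⇔Shared-κ hu hw) w⊥u)) ,
                                   (λ sh → proj₂ (⊥⇔Shared-κ hu hw) (Shared-swap sh))
        }
        where open Coordinates C

      Along : ∀ {A B} → Coordinates A B → B → Subset
      Along C b w = Σ (P w) λ hw → proj₂ (Coordinates.κ C hw) ≡ b

      opaque
        coord : ∀ {w} → P w → Γx.Point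
        coord hw = proj₁ (Γx.point-of (proj₁ (P⇒∼ hw)))

        coord-at : ∀ {w} (hw : P w) → Γx.At w (coord hw)
        coord-at hw = proj₂ (Γx.point-of (proj₁ (P⇒∼ hw)))

      coordinates : Coordinates (Projective.PGPoint Γx.GF 1) (Projective.PGPoint Γx.GF Γx.n)
      coordinates = record
        { κ            = coord
        ; κ-irrelevant = λ h h′ → Γx.At-unique (coord-at h) (coord-at h′)
        ; κ-injective  = λ hu hw eq →
                           At-x-injective hu hw (coord-at hu) (subst (Γx.At _) (sym eq) (coord-at hw))
        ; ⊥⇔Shared-κ   = λ hu hw → Γx.⊥⇔Shared (coord-at hu) (coord-at hw)
        }

      Row : Projective.PGPoint Γx.GF 1 → Subset
      Row = Along (transpose coordinates)

      Column : Projective.PGPoint Γx.GF Γx.n → Subset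
      Column = Along coordinates

      -- Members of one fibre of a split are pairwise ⊥ and members of opposite fibres never are,
      -- while in coordinates ⊥ means sharing a coordinate; so once one vertex of σ₁ shares the
      -- second coordinate with z, all of σ₁ does and all of σ₂ shares the first one.
      module Orientation {A B} (C : Coordinates A B) {z} (hz : P z) (S : Split z)
        (sample≡ : proj₂ (Coordinates.κ C (Split.fibre₁⊆P S (N.someIndex z)))
                 ≡ proj₂ (Coordinates.κ C hz))
        where
        open Coordinates C
        open Split S using (σ₁; σ₂; fibre₁⊆P; fibre₂⊆P; covers; unrelated)
        module Z = N z

        shared-with-z : ∀ {w} (hw : P w) → z ∼ w → Shared (κ hw) (κ hz)
        shared-with-z hw z∼w = proj₁ (⊥⇔Shared-κ hw hz) (inj₂ (∼-sym z∼w))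

        κ≢κz : ∀ {w} (hw : P w) → z ∼ w → κ hw ≢ κ hz
        κ≢κz hw z∼w eq = ∼⇒≢ z∼w (sym (κ-injective hw hz eq))

        sample∈P : P (Z.vertex (Z.someIndex , σ₁))
        sample∈P = fibre₁⊆P Z.someIndex

        on-fibre₁ : ∀ k → proj₂ (κ (fibre₁⊆P k)) ≡ proj₂ (κ hz)
        on-fibre₁ k = Shared⇒≡₂
          (proj₁ (⊥⇔Shared-κ (fibre₁⊆P k) sample∈P)
                 (proj₂ (Z.⊥⇔Shared (k , refl) (Z.someIndex , refl)) (inj₁ refl)))
          (shared-with-z (fibre₁⊆P k) (Z.vertex-∼ _))
          (λ v₁≡z₁ → κ≢κz sample∈P (Z.vertex-∼ _) (cong₂ _,_ v₁≡z₁ sample≡))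
          sample≡

        on-fibre₂ : ∀ k → proj₁ (κ (fibre₂⊆P k)) ≡ proj₁ (κ hz)
        on-fibre₂ k = ¬Shared⇒≡₁
          (λ sh → unrelated (Z.someIndex , refl) (k , refl)
                            (proj₂ (⊥⇔Shared-κ sample∈P (fibre₂⊆P k)) (Shared-sym sh)))
          (shared-with-z (fibre₂⊆P k) (Z.vertex-∼ _))
          sample≡

        fibre₁≐ : Z.Line σ₁ ≐ Along C (proj₂ (κ hz))
        fibre₁≐ w = to , from
          where
          to : Z.Line σ₁ w → Along C (proj₂ (κ hz)) w
          to (zero  , refl) = hz , refl
          to (suc k , refl) = fibre₁⊆P k , on-fibre₁ k
          from : Along C (proj₂ (κ hz)) w → Z.Line σ₁ w
          from (hw , w₂≡z₂) with proj₂ (⊥⇔Shared-κ hw hz) (inj₂ w₂≡z₂)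
          ... | inj₁ refl = zero , refl
          ... | inj₂ w∼z with covers hw (∼-sym w∼z)
          ...   | inj₁ (k , refl) = suc k , refl
          ...   | inj₂ (k , refl) = ⊥-elim (κ≢κz hw (∼-sym w∼z)
                  (cong₂ _,_ (trans (cong proj₁ (κ-irrelevant hw (fibre₂⊆P k))) (on-fibre₂ k)) w₂≡z₂))

        fibre₂≐ : Z.Line σ₂ ≐ Along (transpose C) (proj₁ (κ hz))
        fibre₂≐ w = to , from
          where
          to : Z.Line σ₂ w → Along (transpose C) (proj₁ (κ hz)) w
          to (zero  , refl) = hz , refl
          to (suc k , refl) = fibre₂⊆P k , on-fibre₂ k
          from : Along (transpose C) (proj₁ (κ hz)) w → Z.Line σ₂ w
          from (hw , w₁≡z₁) with proj₂ (⊥⇔Shared-κ hw hz) (inj₁ w₁≡z₁)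
          ... | inj₁ refl = zero , refl
          ... | inj₂ w∼z with covers hw (∼-sym w∼z)
          ...   | inj₂ (k , refl) = suc k , refl
          ...   | inj₁ (k , refl) = ⊥-elim (κ≢κz hw (∼-sym w∼z)
                  (cong₂ _,_ w₁≡z₁ (trans (cong proj₂ (κ-irrelevant hw (fibre₁⊆P k))) (on-fibre₁ k))))

      record Lines {z} (hz : P z) : Set where
        module Z = N z
        field
          row column : Z.Point
          row≐       : Z.Line row ≐ Row (proj₁ (coord hz))
          column≐    : Z.Line column ≐ Column (proj₂ (coord hz))

      lines : ∀ {z} (hz : P z) → Lines hz
      lines {z} hz = orient (split hz)
        where
        orient : Split z → Lines hz
        orient S with proj₂ (coord (Split.fibre₁⊆P S (N.someIndex z))) Γx.≟ₚ proj₂ (coord hz)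
        ... | yes d≡ =
          record { row = Split.σ₂ S ; column = Split.σ₁ S ; row≐ = O.fibre₂≐ ; column≐ = O.fibre₁≐ }
          where module O = Orientation coordinates hz S d≡
        ... | no d≢ =
          record { row = Split.σ₁ S ; column = Split.σ₂ S ; row≐ = O.fibre₁≐ ; column≐ = O.fibre₂≐ }
          where
          c≡ : proj₁ (coord (Split.fibre₁⊆P S (N.someIndex z))) ≡ proj₁ (coord hz)
          c≡ with proj₁ (Coordinates.⊥⇔Shared-κ coordinates (Split.fibre₁⊆P S (N.someIndex z)) hz)
                         (inj₂ (∼-sym (N.vertex-∼ z _)))
          ... | inj₁ c≡ = c≡
          ... | inj₂ d≡ = ⊥-elim (d≢ d≡)
          module O = Orientation (transpose coordinates) hz S c≡

      column-enumeration : ∀ {z} (hz : P z) → Enumeration (suc Γx.q) (Column (proj₂ (coord hz)))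
      column-enumeration {z} hz = subst (λ m → Enumeration (suc m) (Column (proj₂ (coord hz))))
        (sym (q-≡ (proj₁ (P⇒∼ hz))))
        (Enumeration-resp-≐ (Lines.column≐ (lines hz)) (N.line-enumeration z _))

      row-enumeration : ∀ {z} (hz : P z) → Enumeration (suc Γx.q) (Row (proj₁ (coord hz)))
      row-enumeration {z} hz = subst (λ m → Enumeration (suc m) (Row (proj₁ (coord hz))))
        (sym (q-≡ (proj₁ (P⇒∼ hz))))
        (Enumeration-resp-≐ (Lines.row≐ (lines hz)) (N.line-enumeration z _))

      module _ {A B} (C : Coordinates A B) {m b} (E : Enumeration m (Along C b)) where
        open Coordinates C
        open Enumeration E

        first : Fin m → A
        first i = proj₁ (κ (proj₁ (elem-∈ i)))

        first-injective : Injective _≡_ _≡_ first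
        first-injective {i} {j} eq = elem-injective (κ-injective _ _
          (cong₂ _,_ eq (trans (proj₂ (elem-∈ i)) (sym (proj₂ (elem-∈ j))))))

        first-onto : ∀ {w} (w∈ : Along C b w) → ∃[ i ] (first i ≡ proj₁ (κ (proj₁ w∈)))
        first-onto w∈ = let i , eq = elem-onto w∈ in i , cong proj₁ (κ-resp _ (proj₁ w∈) eq)

      -- The column through z has q + 1 members with distinct first coordinates, and PG(1, q) has
      -- only q + 1 points.
      column-full : ∀ {z} (hz : P z) c → ∃[ i ] (first coordinates (column-enumeration hz) i ≡ c)
      column-full hz c =
        let i , eq = injective⇒surjective ℕ.≤-refl
                       (λ eq → first-injective coordinates (column-enumeration hz) (Γx.toFin-injective eq))
                       (Γx.toFin c)
        in i , Γx.toFin-injective eq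

      Cell : Γx.Point → Subset
      Cell s w = Σ (P w) λ hw → coord hw ≡ s

      Cell-unique : ∀ {s u w} → Cell s u → Cell s w → u ≡ w
      Cell-unique (hu , u≡s) (hw , w≡s) = Coordinates.κ-injective coordinates hu hw (trans u≡s (sym w≡s))

      hz₀ : P (proj₁ (proj₂ (proj₂ dist)))
      hz₀ = let _ , x∼z₀ , z₀∼y = proj₂ (proj₂ dist) in inj₂ (∼-sym x∼z₀) , inj₂ z₀∼y

      cᵢ : Fin (suc Γx.q) → Projective.PGPoint Γx.GF 1
      cᵢ = first coordinates (column-enumeration hz₀)

      dⱼ : Fin (suc Γx.q) → Projective.PGPoint Γx.GF Γx.n
      dⱼ = first (transpose coordinates) (row-enumeration hz₀)

      cᵢ-injective : Injective _≡_ _≡_ cᵢ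
      cᵢ-injective = first-injective coordinates (column-enumeration hz₀)

      dⱼ-injective : Injective _≡_ _≡_ dⱼ
      dⱼ-injective = first-injective (transpose coordinates) (row-enumeration hz₀)

      coord-in-grid : ∀ {w} (hw : P w) → ∃[ i ] ∃[ j ] (coord hw ≡ (cᵢ i , dⱼ j))
      coord-in-grid hw =
        let i , cᵢ≡ = column-full hz₀ (proj₁ (coord hw))
            k , c≡c₀ = column-full hw (proj₁ (coord hz₀))
            hu , d≡ = Enumeration.elem-∈ (column-enumeration hw) k
            j , dⱼ≡ = first-onto (transpose coordinates) (row-enumeration hz₀) (hu , c≡c₀)
        in i , j , sym (cong₂ _,_ cᵢ≡ (trans dⱼ≡ d≡))

      -- found in the column through the j-th member of the row through z₀
      cell : ∀ ij → ∃[ w ] Cell (cᵢ (proj₁ ij) , dⱼ (proj₂ ij)) w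
      cell (i , j) =
        let hr , _ = Enumeration.elem-∈ (row-enumeration hz₀) j
            E = column-enumeration hr
            k , c≡ = column-full hr (cᵢ i)
            hw , d≡ = Enumeration.elem-∈ E k
        in Enumeration.elem E k , hw , cong₂ _,_ c≡ d≡

      g : Fin (suc Γx.q) × Fin (suc Γx.q) → X
      g ij = proj₁ (cell ij)

      g-∈P : ∀ ij → P (g ij)
      g-∈P ij = proj₁ (proj₂ (cell ij))

      g-injective : Injective _≡_ _≡_ g
      g-injective {i , j} {i′ , j′} eq =
        let hw , w≡ = proj₂ (cell (i , j))
            hw′ , w′≡ = proj₂ (cell (i′ , j′))
            coords≡ = trans (sym w≡) (trans (Coordinates.κ-resp coordinates hw hw′ eq) w′≡)
        in cong₂ _,_ (cᵢ-injective (cong proj₁ coords≡)) (dⱼ-injective (cong proj₂ coords≡))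

      g-onto : ∀ {w} → P w → ∃[ ij ] (g ij ≡ w)
      g-onto hw = let i , j , eq = coord-in-grid hw in (i , j) , Cell-unique (proj₂ (cell (i , j))) (hw , eq)

      GridRow : Fin (suc Γx.q) → Subset
      GridRow i z = ∃[ j ] (z ≡ g (i , j))

      GridColumn : Fin (suc Γx.q) → Subset
      GridColumn j z = ∃[ i ] (z ≡ g (i , j))

      GridRow≐Row : ∀ i {c} → cᵢ i ≡ c → GridRow i ≐ Row c
      GridRow≐Row i refl w = to , from
        where
        to : GridRow i w → Row (cᵢ i) w
        to (j , refl) = let hw , eq = proj₂ (cell (i , j)) in hw , cong proj₁ eq
        from : Row (cᵢ i) w → GridRow i w
        from (hw , c≡) =
          let i′ , j , eq = coord-in-grid hw
              i′≡i = cᵢ-injective (trans (sym (cong proj₁ eq)) c≡)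
          in j , sym (Cell-unique (proj₂ (cell (i , j))) (hw , trans eq (cong (λ i → cᵢ i , dⱼ j) i′≡i)))

      GridColumn≐Column : ∀ j {d} → dⱼ j ≡ d → GridColumn j ≐ Column d
      GridColumn≐Column j refl w = to , from
        where
        to : GridColumn j w → Column (dⱼ j) w
        to (i , refl) = let hw , eq = proj₂ (cell (i , j)) in hw , cong proj₂ eq
        from : Column (dⱼ j) w → GridColumn j w
        from (hw , d≡) =
          let i , j′ , eq = coord-in-grid hw
              j′≡j = dⱼ-injective (trans (sym (cong proj₂ eq)) d≡)
          in i , sym (Cell-unique (proj₂ (cell (i , j))) (hw , trans eq (cong (λ j → cᵢ i , dⱼ j) j′≡j)))

      Row-∈𝓛 : ∀ {c z} → Row c z → InL (Row c)
      Row-∈𝓛 {z = z} (hz , refl) =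
        z , _ , N.vertex-∼ z _ , ≐-trans (≐-sym row≐) (≐-sym (N.ray≐line z (N.someIndex z , refl)))
        where open Lines (lines hz)

      Column-∈𝓛 : ∀ {d z} → Column d z → InL (Column d)
      Column-∈𝓛 {z = z} (hz , refl) =
        z , _ , N.vertex-∼ z _ , ≐-trans (≐-sym column≐) (≐-sym (N.ray≐line z (N.someIndex z , refl)))
        where open Lines (lines hz)

      GridRow-∈𝓛 : ∀ i → InL (GridRow i)
      GridRow-∈𝓛 i =
        InL-resp-≐ (GridRow≐Row i refl) (Row-∈𝓛 (proj₁ (GridRow≐Row i refl _) (zero , refl)))

      GridColumn-∈𝓛 : ∀ j → InL (GridColumn j)
      GridColumn-∈𝓛 j =
        InL-resp-≐ (GridColumn≐Column j refl) (Column-∈𝓛 (proj₁ (GridColumn≐Column j refl _) (zero , refl)))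

      ray-in-grid : ∀ {p p′} (hp : P p) (hp′ : P p′) → p ∼ p′ →
                    (∃[ i ] (Ray p p′ ≐ GridRow i)) ⊎ (∃[ j ] (Ray p p′ ≐ GridColumn j))
      ray-in-grid {p} hp hp′ p∼p′ =
        by-shared (proj₁ (Coordinates.⊥⇔Shared-κ coordinates hp′ hp) (inj₂ (∼-sym p∼p′)))
        where
        p′≢p = ∼⇒≢ (∼-sym p∼p′)
        i = proj₁ (coord-in-grid hp)
        j = proj₁ (proj₂ (coord-in-grid hp))
        eq = proj₂ (proj₂ (coord-in-grid hp))

        by-shared : Shared (coord hp′) (coord hp) →
                    (∃[ i ] (Ray p _ ≐ GridRow i)) ⊎ (∃[ j ] (Ray p _ ≐ GridColumn j))
        by-shared (inj₁ c≡) = inj₁ (i , ≐-trans (N.ray≐ p (Lines.row≐ (lines hp)) (hp′ , c≡) p′≢p)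
                                               (≐-sym (GridRow≐Row i (cong proj₁ (sym eq)))))
        by-shared (inj₂ d≡) = inj₂ (j , ≐-trans (N.ray≐ p (Lines.column≐ (lines hp)) (hp′ , d≡) p′≢p)
                                               (≐-sym (GridColumn≐Column j (cong proj₂ (sym eq)))))

      lines-in-grid : ∀ L → InL L → L ⊆ P → (∃[ i ] (L ≐ GridRow i)) ⊎ (∃[ j ] (L ≐ GridColumn j))
      lines-in-grid L (p , p′ , p∼p′ , L≐Ray) L⊆P =
        Sum.map (Product.map₂ (≐-trans L≐Ray)) (Product.map₂ (≐-trans L≐Ray))
          (ray-in-grid (L⊆P p (proj₂ (L≐Ray p) (Ray-∋-left p p′)))
                       (L⊆P p′ (proj₂ (L≐Ray p′) (proj₂ (Ray-comm p p′ p′) (Ray-∋-left p′ p))))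
                       p∼p′)

lemma4p1 : (Γ : Graph) → Graph.Connected Γ →
    (loc : (p : Graph.X Γ) → Graph.LocalSegre Γ p) →
    (x y : Graph.X Γ) → Graph.Dist2 Γ x y →
    Graph.IsGridInduced Γ (suc (Graph.LocalSegre.q (loc x)))
      (Graph._∩_ Γ (Graph._⊥ᵥ Γ x) (Graph._⊥ᵥ Γ y))
lemma4p1 Γ _ loc x y dist =
  g , g-injective , g-∈P , (λ _ → g-onto) , lines-in-grid , GridRow-∈𝓛 , GridColumn-∈𝓛
  where open CommonNeighbours Γ loc dist
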